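{- $E^{\partial}_{FTP}$ is sound and complete for bisimilarity on $T(\Sigma^{\partial}_{FTP})$: for all closed $s,t\in T(\Sigma^{\partial}_{FTP})$, $E^{\partial}_{FTP}\vdash s=t$ iff $s\sim t$.
   Context: Fix a finite nonempty set of actions $\mathcal{A}$, a finite set of predicates $\mathcal{P}$, a subset $\mathcal{P}^I\subseteq\mathcal{P}$ and sets $\mathcal{A}_P\subseteq\mathcal{A}$ for $P\in\mathcal{P}^I$. $\Sigma^{\partial}_{FTP}$ consists of constant $\delta$, constants $\kappa_P$ ($P\in\mathcal{P}$), prefixes $a.\_$ ($a\in\mathcal{A}$), binary $+$, and unary $\partial_{\mathcal{B},\mathcal{Q}}$ for $\mathcal{B}\subseteq\mathcal{A}$, $\mathcal{Q}\subseteq\mathcal{P}$. Semantics: least relations closed under $a.x\xrightarrow{a}x$; $x\xrightarrow{a}x'\Rightarrow x+y\xrightarrow{a}x'$; $y\xrightarrow{a}y'\Rightarrow x+y\xrightarrow{a}y'$; $P\kappa_P$; $Px\Rightarrow P(x+y)$; $Py\Rightarrow P(x+y)$; $Px\Rightarrow P(a.x)$ for $P\in\mathcal{P}^I,a\in\mathcal{A}_P$; $x\xrightarrow{a}x'\Rightarrow\partial_{\mathcal{B},\mathcal{Q}}(x)\xrightarrow{a}\partial_{\emptyset,\mathcal{Q}\cap\mathcal{P}^I}(x')$ if $a\notin\mathcal{B}$; $Px\Rightarrow P(\partial_{\mathcal{B},\mathcal{Q}}(x))$ if $P\notin\mathcal{Q}$. $E^{\partial}_{FTP}$: $x+y=y+x$;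 $(x+y)+z=x+(y+z)$; $x+x=x$; $x+\delta=x$; $a.(x+\kappa_P)=a.(x+\kappa_P)+\kappa_P$ ($P\in\mathcal{P}^I,a\in\mathcal{A}_P$); $\partial_{\mathcal{B},\mathcal{Q}}(\delta)=\delta$; $\partial_{\mathcal{B},\mathcal{Q}}(\kappa_P)=\delta$ if $P\in\mathcal{Q}$, $=\kappa_P$ if $P\notin\mathcal{Q}$; for $a\in\mathcal{B}$ and closed $t$, $\partial_{\mathcal{B},\mathcal{Q}}(a.t)=\sum\{\kappa_P\mid P\notin\mathcal{Q}, P(a.t)\}$ (empty sum $\delta$); $\partial_{\mathcal{B},\mathcal{Q}}(a.x)=\partial_{\emptyset,\mathcal{Q}}(a.x)$ if $a\notin\mathcal{B}$; $\partial_{\emptyset,\mathcal{Q}}(a.x)=a.\partial_{\emptyset,\mathcal{Q}\cap\mathcal{P}^I}(x)$; $\partial_{\mathcal{B},\mathcal{Q}}(x+y)=\partial_{\mathcal{B},\mathcal{Q}}(x)+\partial_{\mathcal{B},\mathcal{Q}}(y)$. $\vdash$ is equational-logic derivability; $\sim$ is bisimilarity (related terms match each other's transitions into related terms and satisfy the same predicates). -}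

module Defs where

open import Data.Nat using (ℕ; suc)
open import Data.Fin using (Fin)
open import Data.Fin.Subset using (Subset; _∈_; _∉_; _∩_) renaming (⊥ to ∅)
open import Data.Empty using (⊥)
open import Data.List using (List; []; _∷_)
open import Data.List.Membership.Propositional using () renaming (_∈_ to _∈L_)
open import Data.Product using (Σ; ∃; _×_; _,_)
open import Function.Bundles using (_⇔_)
open import Level using (Level)

-- Parameters:
--   actions     𝒜   = Fin (suc n)   (finite, nonempty)
--   predicates  𝒫   = Fin m         (finite)
--   PI : 𝒫^I ⊆ 𝒫                    (as a Subset m)
--   AP : for each predicate P, the set 𝒜_P ⊆ 𝒜 (only used for P ∈ 𝒫^I)
module FTP (n m : ℕ) (PI : Subset m) (AP : Fin m → Subset (suc n)) where

  Act : Set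
  Act = Fin (suc n)

  Pred : Set
  Pred = Fin m

  data Term (X : Set) : Set where
    var  : X → Term X
    δ    : Term X
    κ    : Pred → Term X
    _∙_  : Act → Term X → Term X
    _⊕_  : Term X → Term X → Term X
    ∂    : Subset (suc n) → Subset m → Term X → Term X

  infixr 7 _∙_
  infixl 6 _⊕_

  Closed : Set
  Closed = Term ⊥

  _[_] : {X Y : Set} → Term X → (X → Term Y) → Term Y
  var x [ σ ] = σ x
  δ [ σ ] = δ
  κ P [ σ ] = κ P
  (a ∙ t) [ σ ] = a ∙ (t [ σ ])
  (t ⊕ u) [ σ ] = (t [ σ ]) ⊕ (u [ σ ])
  ∂ B Q t [ σ ] = ∂ B Q (t [ σ ])

  embed : Closed → Term ℕ
  embed (var ())
  embed δ = δ
  embed (κ P) = κ P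
  embed (a ∙ t) = a ∙ embed t
  embed (t ⊕ u) = embed t ⊕ embed u
  embed (∂ B Q t) = ∂ B Q (embed t)

  data _—[_]→_ {X : Set} : Term X → Act → Term X → Set where
    pre  : ∀ {a x} → (a ∙ x) —[ a ]→ x
    sumˡ : ∀ {x y a x'} → x —[ a ]→ x' → (x ⊕ y) —[ a ]→ x'
    sumʳ : ∀ {x y a y'} → y —[ a ]→ y' → (x ⊕ y) —[ a ]→ y'
    enc  : ∀ {B Q x a x'} → a ∉ B → x —[ a ]→ x' →
           ∂ B Q x —[ a ]→ ∂ ∅ (Q ∩ PI) x'

  data Sat {X : Set} : Pred → Term X → Set where
    sκ   : ∀ {P} → Sat P (κ P)
    sumˡ : ∀ {P x y} → Sat P x → Sat P (x ⊕ y)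
    sumʳ : ∀ {P x y} → Sat P y → Sat P (x ⊕ y)
    spre : ∀ {P a x} → P ∈ PI → a ∈ AP P → Sat P x → Sat P (a ∙ x)
    senc : ∀ {P B Q x} → P ∉ Q → Sat P x → Sat P (∂ B Q x)

  record IsBisimulation (R : Closed → Closed → Set) : Set where
    field
      forth : ∀ {s t a s'} → R s t → s —[ a ]→ s' →
              ∃ λ t' → (t —[ a ]→ t') × R s' t'
      back  : ∀ {s t a t'} → R s t → t —[ a ]→ t' →
              ∃ λ s' → (s —[ a ]→ s') × R s' t'
      predF : ∀ {s t P} → R s t → Sat P s → Sat P t
      predB : ∀ {s t P} → R s t → Sat P t → Sat P s

  _∼_ : Closed → Closed → Set₁
  s ∼ t = Σ (Closed → Closed → Set) λ R → IsBisimulation R × R s t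

  sumκ : List Pred → Term ℕ
  sumκ [] = δ
  sumκ (P ∷ []) = κ P
  sumκ (P ∷ L@(_ ∷ _)) = κ P ⊕ sumκ L

  private
    x y z : Term ℕ
    x = var 0
    y = var 1
    z = var 2

  data Axiom : Term ℕ → Term ℕ → Set where
    comm   : Axiom (x ⊕ y) (y ⊕ x)
    assoc  : Axiom ((x ⊕ y) ⊕ z) (x ⊕ (y ⊕ z))
    idem   : Axiom (x ⊕ x) x
    unit   : Axiom (x ⊕ δ) x
    kappa  : ∀ {P a} → P ∈ PI → a ∈ AP P →
             Axiom (a ∙ (x ⊕ κ P)) ((a ∙ (x ⊕ κ P)) ⊕ κ P)
    ∂δ     : ∀ {B Q} → Axiom (∂ B Q δ) δ
    ∂κin   : ∀ {B Q P} → P ∈ Q → Axiom (∂ B Q (κ P)) δ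
    ∂κout  : ∀ {B Q P} → P ∉ Q → Axiom (∂ B Q (κ P)) (κ P)
    -- ∂_{B,Q}(a.t) = Σ{κ_P | P ∉ Q, P(a.t)} for a ∈ B, t closed;
    -- the sum is given by any list L enumerating exactly that set
    ∂block : ∀ {B Q a} (t : Closed) (L : List Pred) → a ∈ B →
             (∀ P → (P ∈L L) ⇔ (P ∉ Q × Sat P (a ∙ t))) →
             Axiom (∂ B Q (a ∙ embed t)) (sumκ L)
    ∂pass  : ∀ {B Q a} → a ∉ B → Axiom (∂ B Q (a ∙ x)) (∂ ∅ Q (a ∙ x))
    ∂pre   : ∀ {Q a} → Axiom (∂ ∅ Q (a ∙ x)) (a ∙ ∂ ∅ (Q ∩ PI) x)
    ∂sum   : ∀ {B Q} → Axiom (∂ B Q (x ⊕ y)) (∂ B Q x ⊕ ∂ B Q y)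

  data ⊢_≈_ : Term ℕ → Term ℕ → Set where
    ax     : ∀ {l r} → Axiom l r → ⊢ l ≈ r
    refl   : ∀ {t} → ⊢ t ≈ t
    sym    : ∀ {t u} → ⊢ t ≈ u → ⊢ u ≈ t
    trans  : ∀ {t u v} → ⊢ t ≈ u → ⊢ u ≈ v → ⊢ t ≈ v
    subst  : ∀ {t u} (σ : ℕ → Term ℕ) → ⊢ t ≈ u → ⊢ (t [ σ ]) ≈ (u [ σ ])
    cong∙  : ∀ {a t u} → ⊢ t ≈ u → ⊢ (a ∙ t) ≈ (a ∙ u)
    cong⊕  : ∀ {t t' u u'} → ⊢ t ≈ t' → ⊢ u ≈ u' → ⊢ (t ⊕ u) ≈ (t' ⊕ u')
    cong∂  : ∀ {B Q t u} → ⊢ t ≈ u → ⊢ ∂ B Q t ≈ ∂ B Q u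

-- Soundness.  Call an equation t = u between open terms *valid* when every
-- substitution instance t[σ], u[σ] satisfies the same predicates and matches
-- each other's transitions with residuals that are again provably equal
-- ('Transfer').  Each axiom is valid, and validity is preserved by every rule
-- of equational logic; hence on closed terms provable equality is itself a
-- bisimulation, so provably equal terms are bisimilar.
--
-- Completeness.  Every closed term is provably equal to a *basic* term (one
-- built from δ, κ_P, prefix and +, i.e. without ∂), because the ∂-axioms
-- push ∂ through sums and prefixes and erase it at blocked prefixes.  On
-- basic terms we read + as a join: c ≼ b means b + c = b.  A basic term b
-- whose steps and predicates are all matched by a basic b' satisfies b ≼ b';
-- by induction on depth, bisimilar basic terms are therefore ≼ each other,
-- hence provably equal.  Bisimilar closed terms have bisimilar normal forms.
module Submission where

open import Defs
open import Data.Nat using (ℕ; suc; zero; _≤_; _⊔_; s≤s)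
open import Data.Nat.Properties using (m≤m⊔n; m≤n⊔m)
open import Data.Fin using (Fin; _≟_)
open import Data.Fin.Subset using (Subset; _∈_; _∉_; _∩_) renaming (⊥ to ∅)
open import Data.Fin.Subset.Properties using (_∈?_; ∉⊥; x∈p∩q⁺; x∈p∩q⁻)
open import Data.Empty using (⊥-elim)
open import Data.List using (List; []; _∷_; filter; allFin)
open import Data.List.Membership.Propositional using () renaming (_∈_ to _∈L_)
open import Data.List.Membership.Propositional.Properties using (∈-filter⁺; ∈-filter⁻; ∈-allFin)
open import Data.List.Relation.Unary.Any using (here; there)
open import Data.Product using (∃; ∃₂; _×_; _,_; proj₁; proj₂)
open import Data.Product.Function.NonDependent.Propositional using (_×-⇔_)
open import Function using (_∘_)
open import Function.Bundles using (_⇔_; mk⇔; module Equivalence)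
open import Function.Construct.Composition using (_⇔-∘_)
open import Function.Construct.Identity using (⇔-id)
open import Function.Construct.Symmetry using (⇔-sym)
open import Relation.Nullary using (Dec; yes; no; ¬_)
open import Relation.Nullary.Decidable using (_×-dec_; ¬?)
open import Relation.Unary using (Decidable)
open import Relation.Binary.Bundles using (Setoid)
import Relation.Binary.Reasoning.Setoid as SetoidReasoning
import Relation.Binary.PropositionalEquality as ≡

module Axiomatisation (n m : ℕ) (PI : Subset m) (AP : Fin m → Subset (suc n)) where
  open FTP n m PI AP
  open Equivalence using (to; from)

  _⊙_ : (ℕ → Term ℕ) → (ℕ → Term ℕ) → ℕ → Term ℕ
  (σ₁ ⊙ σ) k = σ₁ k [ σ ]

  sub-comp : ∀ (t : Term ℕ) σ₁ σ → (t [ σ₁ ]) [ σ ] ≡.≡ t [ σ₁ ⊙ σ ]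
  sub-comp (var x) σ₁ σ = ≡.refl
  sub-comp δ _ _ = ≡.refl
  sub-comp (κ P) _ _ = ≡.refl
  sub-comp (a ∙ t) σ₁ σ = ≡.cong (a ∙_) (sub-comp t σ₁ σ)
  sub-comp (t ⊕ u) σ₁ σ = ≡.cong₂ _⊕_ (sub-comp t σ₁ σ) (sub-comp u σ₁ σ)
  sub-comp (∂ B Q t) σ₁ σ = ≡.cong (∂ B Q) (sub-comp t σ₁ σ)

  embed-closed : ∀ (t : Closed) σ → embed t [ σ ] ≡.≡ embed t
  embed-closed (var ())
  embed-closed δ σ = ≡.refl
  embed-closed (κ P) σ = ≡.refl
  embed-closed (a ∙ t) σ = ≡.cong (a ∙_) (embed-closed t σ)
  embed-closed (t ⊕ u) σ = ≡.cong₂ _⊕_ (embed-closed t σ) (embed-closed u σ)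
  embed-closed (∂ B Q t) σ = ≡.cong (∂ B Q) (embed-closed t σ)

  embed-step : ∀ {s a s'} → s —[ a ]→ s' → embed s —[ a ]→ embed s'
  embed-step pre = pre
  embed-step (sumˡ tr) = sumˡ (embed-step tr)
  embed-step (sumʳ tr) = sumʳ (embed-step tr)
  embed-step (enc a∉B tr) = enc a∉B (embed-step tr)

  embed-step⁻ : ∀ (s : Closed) {a w} → embed s —[ a ]→ w →
                ∃ λ s' → (s —[ a ]→ s') × (w ≡.≡ embed s')
  embed-step⁻ (var ()) tr
  embed-step⁻ (a ∙ s) pre = s , pre , ≡.refl
  embed-step⁻ (s ⊕ u) (sumˡ tr) with embed-step⁻ s tr
  ... | s' , tr' , eq = s' , sumˡ tr' , eq
  embed-step⁻ (s ⊕ u) (sumʳ tr) with embed-step⁻ u tr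
  ... | u' , tr' , eq = u' , sumʳ tr' , eq
  embed-step⁻ (∂ B Q s) (enc a∉B tr) with embed-step⁻ s tr
  ... | s' , tr' , eq = ∂ ∅ (Q ∩ PI) s' , enc a∉B tr' , ≡.cong (∂ ∅ (Q ∩ PI)) eq

  embed-sat : ∀ (s : Closed) {P} → Sat P (embed s) ⇔ Sat P s
  embed-sat s = mk⇔ (reflect s) preserve
    where
    reflect : ∀ (s : Closed) {P} → Sat P (embed s) → Sat P s
    reflect (var ()) _
    reflect (κ P) sκ = sκ
    reflect (a ∙ s) (spre p∈PI a∈AP sat) = spre p∈PI a∈AP (reflect s sat)
    reflect (s ⊕ u) (sumˡ sat) = sumˡ (reflect s sat)
    reflect (s ⊕ u) (sumʳ sat) = sumʳ (reflect u sat)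
    reflect (∂ B Q s) (senc p∉Q sat) = senc p∉Q (reflect s sat)
    preserve : ∀ {s : Closed} {P} → Sat P s → Sat P (embed s)
    preserve sκ = sκ
    preserve (sumˡ sat) = sumˡ (preserve sat)
    preserve (sumʳ sat) = sumʳ (preserve sat)
    preserve (spre p∈PI a∈AP sat) = spre p∈PI a∈AP (preserve sat)
    preserve (senc p∉Q sat) = senc p∉Q (preserve sat)

  sumκ-inert : ∀ L {a w} → ¬ (sumκ L —[ a ]→ w)
  sumκ-inert (P ∷ P' ∷ L) (sumʳ tr) = sumκ-inert (P' ∷ L) tr

  sumκ-sat : ∀ L {P} → Sat P (sumκ L) ⇔ (P ∈L L)
  sumκ-sat L = mk⇔ (listed L) (satisfied L)
    where
    listed : ∀ L {P} → Sat P (sumκ L) → P ∈L L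
    listed (P ∷ []) sκ = here ≡.refl
    listed (P ∷ P' ∷ L) (sumˡ sκ) = here ≡.refl
    listed (P ∷ P' ∷ L) (sumʳ sat) = there (listed (P' ∷ L) sat)
    satisfied : ∀ L {P} → P ∈L L → Sat P (sumκ L)
    satisfied (P ∷ []) (here ≡.refl) = sκ
    satisfied (P ∷ P' ∷ L) (here ≡.refl) = sumˡ sκ
    satisfied (P ∷ P' ∷ L) (there i) = sumʳ (satisfied (P' ∷ L) i)

  sumκ-subst : ∀ L σ → sumκ L [ σ ] ≡.≡ sumκ L
  sumκ-subst [] σ = ≡.refl
  sumκ-subst (P ∷ []) σ = ≡.refl
  sumκ-subst (P ∷ P' ∷ L) σ = ≡.cong (κ P ⊕_) (sumκ-subst (P' ∷ L) σ)

  record Transfer (t u : Term ℕ) : Set where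
    field
      forth : ∀ {a t'} → t —[ a ]→ t' → ∃ λ u' → (u —[ a ]→ u') × ⊢ t' ≈ u'
      back  : ∀ {a u'} → u —[ a ]→ u' → ∃ λ t' → (t —[ a ]→ t') × ⊢ t' ≈ u'
      predF : ∀ {P} → Sat P t → Sat P u
      predB : ∀ {P} → Sat P u → Sat P t
  open Transfer

  Valid : Term ℕ → Term ℕ → Set
  Valid t u = ∀ σ → Transfer (t [ σ ]) (u [ σ ])

  transfer-refl : ∀ {t} → Transfer t t
  forth transfer-refl tr = _ , tr , refl
  back transfer-refl tr = _ , tr , refl
  predF transfer-refl sat = sat
  predB transfer-refl sat = sat

  transfer-sym : ∀ {t u} → Transfer t u → Transfer u t
  forth (transfer-sym T) tr with back T tr
  ... | t' , tr' , eq = t' , tr' , sym eq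
  back (transfer-sym T) tr with forth T tr
  ... | u' , tr' , eq = u' , tr' , sym eq
  predF (transfer-sym T) = predB T
  predB (transfer-sym T) = predF T

  transfer-trans : ∀ {t u v} → Transfer t u → Transfer u v → Transfer t v
  forth (transfer-trans T U) tr with forth T tr
  ... | u' , tr₁ , eq₁ with forth U tr₁
  ...   | v' , tr₂ , eq₂ = v' , tr₂ , trans eq₁ eq₂
  back (transfer-trans T U) tr with back U tr
  ... | u' , tr₁ , eq₁ with back T tr₁
  ...   | t' , tr₂ , eq₂ = t' , tr₂ , trans eq₂ eq₁
  predF (transfer-trans T U) = predF U ∘ predF T
  predB (transfer-trans T U) = predB T ∘ predB U

  transfer-∙ : ∀ {a t u} → ⊢ t ≈ u → Transfer t u → Transfer (a ∙ t) (a ∙ u)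
  forth (transfer-∙ t≈u _) pre = _ , pre , t≈u
  back (transfer-∙ t≈u _) pre = _ , pre , t≈u
  predF (transfer-∙ _ T) (spre p∈PI a∈AP sat) = spre p∈PI a∈AP (predF T sat)
  predB (transfer-∙ _ T) (spre p∈PI a∈AP sat) = spre p∈PI a∈AP (predB T sat)

  transfer-⊕ : ∀ {t t' u u'} → Transfer t t' → Transfer u u' → Transfer (t ⊕ u) (t' ⊕ u')
  forth (transfer-⊕ T U) (sumˡ tr) with forth T tr
  ... | w , tr' , eq = w , sumˡ tr' , eq
  forth (transfer-⊕ T U) (sumʳ tr) with forth U tr
  ... | w , tr' , eq = w , sumʳ tr' , eq
  back (transfer-⊕ T U) (sumˡ tr) with back T tr
  ... | w , tr' , eq = w , sumˡ tr' , eq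
  back (transfer-⊕ T U) (sumʳ tr) with back U tr
  ... | w , tr' , eq = w , sumʳ tr' , eq
  predF (transfer-⊕ T U) (sumˡ sat) = sumˡ (predF T sat)
  predF (transfer-⊕ T U) (sumʳ sat) = sumʳ (predF U sat)
  predB (transfer-⊕ T U) (sumˡ sat) = sumˡ (predB T sat)
  predB (transfer-⊕ T U) (sumʳ sat) = sumʳ (predB U sat)

  transfer-∂ : ∀ {B Q t u} → Transfer t u → Transfer (∂ B Q t) (∂ B Q u)
  forth (transfer-∂ T) (enc a∉B tr) with forth T tr
  ... | w , tr' , eq = _ , enc a∉B tr' , cong∂ eq
  back (transfer-∂ T) (enc a∉B tr) with back T tr
  ... | w , tr' , eq = _ , enc a∉B tr' , cong∂ eq
  predF (transfer-∂ T) (senc p∉Q sat) = senc p∉Q (predF T sat)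
  predB (transfer-∂ T) (senc p∉Q sat) = senc p∉Q (predB T sat)

  ⊕-comm : ∀ {t u} → Transfer (t ⊕ u) (u ⊕ t)
  forth ⊕-comm (sumˡ tr) = _ , sumʳ tr , refl
  forth ⊕-comm (sumʳ tr) = _ , sumˡ tr , refl
  back ⊕-comm (sumˡ tr) = _ , sumʳ tr , refl
  back ⊕-comm (sumʳ tr) = _ , sumˡ tr , refl
  predF ⊕-comm (sumˡ sat) = sumʳ sat
  predF ⊕-comm (sumʳ sat) = sumˡ sat
  predB ⊕-comm (sumˡ sat) = sumʳ sat
  predB ⊕-comm (sumʳ sat) = sumˡ sat

  ⊕-assoc : ∀ {t u v} → Transfer ((t ⊕ u) ⊕ v) (t ⊕ (u ⊕ v))
  forth ⊕-assoc (sumˡ (sumˡ tr)) = _ , sumˡ tr , refl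
  forth ⊕-assoc (sumˡ (sumʳ tr)) = _ , sumʳ (sumˡ tr) , refl
  forth ⊕-assoc (sumʳ tr) = _ , sumʳ (sumʳ tr) , refl
  back ⊕-assoc (sumˡ tr) = _ , sumˡ (sumˡ tr) , refl
  back ⊕-assoc (sumʳ (sumˡ tr)) = _ , sumˡ (sumʳ tr) , refl
  back ⊕-assoc (sumʳ (sumʳ tr)) = _ , sumʳ tr , refl
  predF ⊕-assoc (sumˡ (sumˡ sat)) = sumˡ sat
  predF ⊕-assoc (sumˡ (sumʳ sat)) = sumʳ (sumˡ sat)
  predF ⊕-assoc (sumʳ sat) = sumʳ (sumʳ sat)
  predB ⊕-assoc (sumˡ sat) = sumˡ (sumˡ sat)
  predB ⊕-assoc (sumʳ (sumˡ sat)) = sumˡ (sumʳ sat)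
  predB ⊕-assoc (sumʳ (sumʳ sat)) = sumʳ sat

  ⊕-idem : ∀ {t} → Transfer (t ⊕ t) t
  forth ⊕-idem (sumˡ tr) = _ , tr , refl
  forth ⊕-idem (sumʳ tr) = _ , tr , refl
  back ⊕-idem tr = _ , sumˡ tr , refl
  predF ⊕-idem (sumˡ sat) = sat
  predF ⊕-idem (sumʳ sat) = sat
  predB ⊕-idem sat = sumˡ sat

  ⊕-unit : ∀ {t} → Transfer (t ⊕ δ) t
  forth ⊕-unit (sumˡ tr) = _ , tr , refl
  back ⊕-unit tr = _ , sumˡ tr , refl
  predF ⊕-unit (sumˡ sat) = sat
  predB ⊕-unit sat = sumˡ sat

  κ-inherit : ∀ {P a t} → P ∈ PI → a ∈ AP P → Transfer (a ∙ (t ⊕ κ P)) ((a ∙ (t ⊕ κ P)) ⊕ κ P)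
  forth (κ-inherit _ _) pre = _ , sumˡ pre , refl
  back (κ-inherit _ _) (sumˡ pre) = _ , pre , refl
  predF (κ-inherit _ _) sat = sumˡ sat
  predB (κ-inherit _ _) (sumˡ sat) = sat
  predB (κ-inherit p∈PI a∈AP) (sumʳ sκ) = spre p∈PI a∈AP (sumʳ sκ)

  ∂-δ : ∀ {B Q} → Transfer (∂ B Q δ) δ
  forth ∂-δ (enc _ ())
  back ∂-δ ()
  predF ∂-δ (senc _ ())
  predB ∂-δ ()

  ∂-κ-in : ∀ {B Q P} → P ∈ Q → Transfer (∂ B Q (κ P)) δ
  forth (∂-κ-in _) (enc _ ())
  back (∂-κ-in _) ()
  predF (∂-κ-in p∈Q) (senc p∉Q sκ) = ⊥-elim (p∉Q p∈Q)
  predB (∂-κ-in _) ()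

  ∂-κ-out : ∀ {B Q P} → P ∉ Q → Transfer (∂ B Q (κ P)) (κ P)
  forth (∂-κ-out _) (enc _ ())
  back (∂-κ-out _) ()
  predF (∂-κ-out _) (senc _ sat) = sat
  predB (∂-κ-out p∉Q) sκ = senc p∉Q sκ

  ∂-block : ∀ {B Q a u} L → a ∈ B → (∀ P → (P ∈L L) ⇔ (P ∉ Q × Sat P (a ∙ u))) →
            Transfer (∂ B Q (a ∙ u)) (sumκ L)
  forth (∂-block L a∈B _) (enc a∉B pre) = ⊥-elim (a∉B a∈B)
  back (∂-block L _ _) tr = ⊥-elim (sumκ-inert L tr)
  predF (∂-block L _ survivors) {P} (senc p∉Q sat) = from (sumκ-sat L) (from (survivors P) (p∉Q , sat))
  predB (∂-block L _ survivors) {P} sat with to (survivors P) (to (sumκ-sat L) sat)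
  ... | p∉Q , sat' = senc p∉Q sat'

  ∂-pass : ∀ {B Q a t} → a ∉ B → Transfer (∂ B Q (a ∙ t)) (∂ ∅ Q (a ∙ t))
  forth (∂-pass _) (enc _ pre) = _ , enc ∉⊥ pre , refl
  back (∂-pass a∉B) (enc _ pre) = _ , enc a∉B pre , refl
  predF (∂-pass _) (senc p∉Q sat) = senc p∉Q sat
  predB (∂-pass _) (senc p∉Q sat) = senc p∉Q sat

  ∂-pre : ∀ {Q a t} → Transfer (∂ ∅ Q (a ∙ t)) (a ∙ ∂ ∅ (Q ∩ PI) t)
  forth ∂-pre (enc _ pre) = _ , pre , refl
  back ∂-pre pre = _ , enc ∉⊥ pre , refl
  predF (∂-pre {Q}) (senc p∉Q (spre p∈PI a∈AP sat)) =
    spre p∈PI a∈AP (senc (p∉Q ∘ proj₁ ∘ x∈p∩q⁻ Q PI) sat)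
  predB ∂-pre (spre p∈PI a∈AP (senc p∉Q∩PI sat)) =
    senc (λ p∈Q → p∉Q∩PI (x∈p∩q⁺ (p∈Q , p∈PI))) (spre p∈PI a∈AP sat)

  ∂-⊕ : ∀ {B Q t u} → Transfer (∂ B Q (t ⊕ u)) (∂ B Q t ⊕ ∂ B Q u)
  forth ∂-⊕ (enc a∉B (sumˡ tr)) = _ , sumˡ (enc a∉B tr) , refl
  forth ∂-⊕ (enc a∉B (sumʳ tr)) = _ , sumʳ (enc a∉B tr) , refl
  back ∂-⊕ (sumˡ (enc a∉B tr)) = _ , enc a∉B (sumˡ tr) , refl
  back ∂-⊕ (sumʳ (enc a∉B tr)) = _ , enc a∉B (sumʳ tr) , refl
  predF ∂-⊕ (senc p∉Q (sumˡ sat)) = sumˡ (senc p∉Q sat)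
  predF ∂-⊕ (senc p∉Q (sumʳ sat)) = sumʳ (senc p∉Q sat)
  predB ∂-⊕ (sumˡ (senc p∉Q sat)) = senc p∉Q (sumˡ sat)
  predB ∂-⊕ (sumʳ (senc p∉Q sat)) = senc p∉Q (sumʳ sat)

  axiom-valid : ∀ {l r} → Axiom l r → Valid l r
  axiom-valid comm σ = ⊕-comm
  axiom-valid assoc σ = ⊕-assoc
  axiom-valid idem σ = ⊕-idem
  axiom-valid unit σ = ⊕-unit
  axiom-valid (kappa p∈PI a∈AP) σ = κ-inherit p∈PI a∈AP
  axiom-valid ∂δ σ = ∂-δ
  axiom-valid (∂κin p∈Q) σ = ∂-κ-in p∈Q
  axiom-valid (∂κout p∉Q) σ = ∂-κ-out p∉Q
  axiom-valid (∂block {a = a} t L a∈B survivors) σ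
    rewrite embed-closed t σ | sumκ-subst L σ =
      ∂-block L a∈B (λ P → ⇔-sym (⇔-id _ ×-⇔ embed-sat (a ∙ t)) ⇔-∘ survivors P)
  axiom-valid (∂pass a∉B) σ = ∂-pass a∉B
  axiom-valid ∂pre σ = ∂-pre
  axiom-valid ∂sum σ = ∂-⊕

  sound : ∀ {t u} → ⊢ t ≈ u → Valid t u
  sound (ax A) = axiom-valid A
  sound refl σ = transfer-refl
  sound (sym d) σ = transfer-sym (sound d σ)
  sound (trans d e) σ = transfer-trans (sound d σ) (sound e σ)
  sound (subst {t} {u} σ₁ d) σ =
    ≡.subst₂ Transfer (≡.sym (sub-comp t σ₁ σ)) (≡.sym (sub-comp u σ₁ σ)) (sound d (σ₁ ⊙ σ))
  sound (cong∙ d) σ = transfer-∙ (subst σ d) (sound d σ)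
  sound (cong⊕ d e) σ = transfer-⊕ (sound d σ) (sound e σ)
  sound (cong∂ d) σ = transfer-∂ (sound d σ)

  _≐_ : Closed → Closed → Set
  s ≐ t = ⊢ embed s ≈ embed t
  infix 4 _≐_

  ≐-transfer : ∀ {s t} → s ≐ t → Transfer (embed s) (embed t)
  ≐-transfer {s} {t} d = ≡.subst₂ Transfer (embed-closed s var) (embed-closed t var) (sound d var)

  ≐-bisimulation : IsBisimulation _≐_
  IsBisimulation.forth ≐-bisimulation {t = t} d tr with forth (≐-transfer d) (embed-step tr)
  ... | w , tr' , eq with embed-step⁻ t tr'
  ...   | t' , tr'' , ≡.refl = t' , tr'' , eq
  IsBisimulation.back ≐-bisimulation {s = s} d tr with back (≐-transfer d) (embed-step tr)
  ... | w , tr' , eq with embed-step⁻ s tr'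
  ...   | s' , tr'' , ≡.refl = s' , tr'' , eq
  IsBisimulation.predF ≐-bisimulation {s} {t} d =
    to (embed-sat t) ∘ predF (≐-transfer d) ∘ from (embed-sat s)
  IsBisimulation.predB ≐-bisimulation {s} {t} d =
    to (embed-sat s) ∘ predB (≐-transfer d) ∘ from (embed-sat t)

  provable⇒bisimilar : ∀ {s t} → s ≐ t → s ∼ t
  provable⇒bisimilar d = _≐_ , ≐-bisimulation , d

  ∼-sym : ∀ {s t} → s ∼ t → t ∼ s
  ∼-sym (R , isB , r) = (λ s t → R t s) , converse , r
    where
    module R = IsBisimulation isB
    converse : IsBisimulation (λ s t → R t s)
    converse = record { forth = R.back ; back = R.forth ; predF = R.predB ; predB = R.predF }

  ∼-trans : ∀ {s t u} → s ∼ t → t ∼ u → s ∼ u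
  ∼-trans {t = t} (R , isR , r) (S , isS , r') = R⨾S , composite , (t , r , r')
    where
    module R = IsBisimulation isR
    module S = IsBisimulation isS
    R⨾S : Closed → Closed → Set
    R⨾S x z = ∃ λ y → R x y × S y z
    composite : IsBisimulation R⨾S
    IsBisimulation.forth composite (y , xRy , ySz) tr with R.forth xRy tr
    ... | y' , tr₁ , xRy' with S.forth ySz tr₁
    ...   | z' , tr₂ , ySz' = z' , tr₂ , (y' , xRy' , ySz')
    IsBisimulation.back composite (y , xRy , ySz) tr with S.back ySz tr
    ... | y' , tr₁ , ySz' with R.back xRy tr₁
    ...   | x' , tr₂ , xRy' = x' , tr₂ , (y' , xRy' , ySz')
    IsBisimulation.predF composite (y , xRy , ySz) = S.predF ySz ∘ R.predF xRy
    IsBisimulation.predB composite (y , xRy , ySz) = R.predB xRy ∘ S.predB ySz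

  ∼-sat : ∀ {s t P} → s ∼ t → Sat P s → Sat P t
  ∼-sat (R , isB , r) = IsBisimulation.predF isB r

  data Basic : ℕ → Closed → Set where
    bδ : ∀ {k} → Basic k δ
    bκ : ∀ {k P} → Basic k (κ P)
    b∙ : ∀ {k a t} → Basic k t → Basic (suc k) (a ∙ t)
    b⊕ : ∀ {k t u} → Basic k t → Basic k u → Basic k (t ⊕ u)

  basic-weaken : ∀ {j k b} → j ≤ k → Basic j b → Basic k b
  basic-weaken _ bδ = bδ
  basic-weaken _ bκ = bκ
  basic-weaken (s≤s j≤k) (b∙ bt) = b∙ (basic-weaken j≤k bt)
  basic-weaken j≤k (b⊕ bt bu) = b⊕ (basic-weaken j≤k bt) (basic-weaken j≤k bu)

  basic-step : ∀ {k s a t} → Basic (suc k) s → s —[ a ]→ t → Basic k t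
  basic-step (b∙ bt) pre = bt
  basic-step (b⊕ bs _) (sumˡ tr) = basic-step bs tr
  basic-step (b⊕ _ bu) (sumʳ tr) = basic-step bu tr

  basic-inert : ∀ {s a t} → Basic 0 s → ¬ (s —[ a ]→ t)
  basic-inert (b⊕ bs _) (sumˡ tr) = basic-inert bs tr
  basic-inert (b⊕ _ bu) (sumʳ tr) = basic-inert bu tr

  ≐-setoid : Setoid _ _
  ≐-setoid = record
    { Carrier = Closed
    ; _≈_ = _≐_
    ; isEquivalence = record { refl = refl ; sym = sym ; trans = trans }
    }
  open SetoidReasoning ≐-setoid using (begin_; step-≈-⟩; step-≈-⟨; _∎)

  ⟪_,_,_⟫ : Closed → Closed → Closed → ℕ → Term ℕ
  ⟪ s , t , u ⟫ zero = embed s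
  ⟪ s , t , u ⟫ (suc zero) = embed t
  ⟪ s , t , u ⟫ (suc (suc _)) = embed u

  ≐-comm : ∀ s t → s ⊕ t ≐ t ⊕ s
  ≐-comm s t = subst ⟪ s , t , δ ⟫ (ax comm)

  ≐-assoc : ∀ s t u → (s ⊕ t) ⊕ u ≐ s ⊕ (t ⊕ u)
  ≐-assoc s t u = subst ⟪ s , t , u ⟫ (ax assoc)

  ≐-idem : ∀ s → s ⊕ s ≐ s
  ≐-idem s = subst ⟪ s , δ , δ ⟫ (ax idem)

  ≐-unit : ∀ s → s ⊕ δ ≐ s
  ≐-unit s = subst ⟪ s , δ , δ ⟫ (ax unit)

  _≼_ : Closed → Closed → Set
  c ≼ b = b ⊕ c ≐ b
  infix 4 _≼_

  ≼-refl : ∀ {b} → b ≼ b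
  ≼-refl {b} = ≐-idem b

  δ≼ : ∀ {b} → δ ≼ b
  δ≼ {b} = ≐-unit b

  ≼-resp : ∀ {b c c'} → c ≐ c' → c' ≼ b → c ≼ b
  ≼-resp c≐c' c'≼b = trans (cong⊕ refl c≐c') c'≼b

  ≼-⊕ˡ : ∀ {c x y} → c ≼ x → c ≼ x ⊕ y
  ≼-⊕ˡ {c} {x} {y} c≼x = begin
    (x ⊕ y) ⊕ c  ≈⟨ ≐-assoc x y c ⟩
    x ⊕ (y ⊕ c)  ≈⟨ cong⊕ refl (≐-comm y c) ⟩
    x ⊕ (c ⊕ y)  ≈⟨ ≐-assoc x c y ⟨
    (x ⊕ c) ⊕ y  ≈⟨ cong⊕ c≼x refl ⟩
    x ⊕ y        ∎

  ≼-⊕ʳ : ∀ {c x y} → c ≼ y → c ≼ x ⊕ y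
  ≼-⊕ʳ {c} {x} {y} c≼y = trans (≐-assoc x y c) (cong⊕ refl c≼y)

  ≼-join : ∀ {b c d} → c ≼ b → d ≼ b → c ⊕ d ≼ b
  ≼-join {b} {c} {d} c≼b d≼b = begin
    b ⊕ (c ⊕ d)  ≈⟨ ≐-assoc b c d ⟨
    (b ⊕ c) ⊕ d  ≈⟨ cong⊕ c≼b refl ⟩
    b ⊕ d        ≈⟨ d≼b ⟩
    b            ∎

  ≼-antisym : ∀ {b b'} → b ≼ b' → b' ≼ b → b ≐ b'
  ≼-antisym {b} {b'} b≼b' b'≼b = begin
    b       ≈⟨ b'≼b ⟨
    b ⊕ b'  ≈⟨ ≐-comm b b' ⟩
    b' ⊕ b  ≈⟨ b≼b' ⟩
    b'      ∎

  sat⇒κ≼ : ∀ {k b P} → Basic k b → Sat P b → κ P ≼ b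
  sat⇒κ≼ bκ sκ = ≼-refl
  sat⇒κ≼ (b⊕ bx _) (sumˡ sat) = ≼-⊕ˡ (sat⇒κ≼ bx sat)
  sat⇒κ≼ (b⊕ _ by) (sumʳ sat) = ≼-⊕ʳ (sat⇒κ≼ by sat)
  sat⇒κ≼ {P = P} (b∙ {a = a} {t = x} bx) (spre p∈PI a∈AP sat) = begin
    (a ∙ x) ⊕ κ P            ≈⟨ cong⊕ (cong∙ (sym κP≼x)) refl ⟩
    (a ∙ (x ⊕ κ P)) ⊕ κ P    ≈⟨ subst ⟪ x , δ , δ ⟫ (ax (kappa p∈PI a∈AP)) ⟨
    a ∙ (x ⊕ κ P)            ≈⟨ cong∙ κP≼x ⟩
    a ∙ x                    ∎
    where
    κP≼x : κ P ≼ x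
    κP≼x = sat⇒κ≼ bx sat

  step⇒≼ : ∀ {k b a t} → Basic k b → b —[ a ]→ t → a ∙ t ≼ b
  step⇒≼ (b∙ _) pre = ≼-refl
  step⇒≼ (b⊕ bx _) (sumˡ tr) = ≼-⊕ˡ (step⇒≼ bx tr)
  step⇒≼ (b⊕ _ by) (sumʳ tr) = ≼-⊕ʳ (step⇒≼ by tr)

  StepsMatched : Closed → Closed → Set
  StepsMatched b b' = ∀ {a t} → b —[ a ]→ t → ∃ λ t' → (b' —[ a ]→ t') × t ≐ t'

  PredsIncluded : Closed → Closed → Set
  PredsIncluded b b' = ∀ {P} → Sat P b → Sat P b'

  simulated⇒≼ : ∀ {j k b b'} → Basic j b → Basic k b' →
                StepsMatched b b' → PredsIncluded b b' → b ≼ b'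
  simulated⇒≼ bδ _ _ _ = δ≼
  simulated⇒≼ bκ bb' _ preds = sat⇒κ≼ bb' (preds sκ)
  simulated⇒≼ (b∙ _) bb' steps _ with steps pre
  ... | t' , tr' , t≐t' = ≼-resp (cong∙ t≐t') (step⇒≼ bb' tr')
  simulated⇒≼ (b⊕ bx by) bb' steps preds =
    ≼-join (simulated⇒≼ bx bb' (steps ∘ sumˡ) (preds ∘ sumˡ))
           (simulated⇒≼ by bb' (steps ∘ sumʳ) (preds ∘ sumʳ))

  bisimilar-basic : ∀ {k b b'} → Basic k b → Basic k b' → b ∼ b' → b ≐ b'
  bisimilar-steps : ∀ {k b b'} → Basic k b → Basic k b' → b ∼ b' → StepsMatched b b'

  bisimilar-basic bb bb' b∼b' =
    ≼-antisym (simulated⇒≼ bb bb' (bisimilar-steps bb bb' b∼b') (∼-sat b∼b'))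
              (simulated⇒≼ bb' bb (bisimilar-steps bb' bb (∼-sym b∼b')) (∼-sat (∼-sym b∼b')))

  bisimilar-steps {zero} bb _ _ tr = ⊥-elim (basic-inert bb tr)
  bisimilar-steps {suc k} bb bb' (R , isB , r) tr with IsBisimulation.forth isB r tr
  ... | t' , tr' , r' = t' , tr' , bisimilar-basic (basic-step bb tr) (basic-step bb' tr') (R , isB , r')

  sat? : ∀ P (t : Closed) → Dec (Sat P t)
  sat? P (var ())
  sat? P δ = no (λ ())
  sat? P (κ P') with P ≟ P'
  ... | yes ≡.refl = yes sκ
  ... | no P≢P' = no (λ { sκ → P≢P' ≡.refl })
  sat? P (a ∙ t) with P ∈? PI | a ∈? AP P | sat? P t
  ... | yes p∈PI | yes a∈AP | yes sat = yes (spre p∈PI a∈AP sat)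
  ... | no p∉PI | _ | _ = no (λ { (spre p∈PI _ _) → p∉PI p∈PI })
  ... | yes _ | no a∉AP | _ = no (λ { (spre _ a∈AP _) → a∉AP a∈AP })
  ... | yes _ | yes _ | no ¬sat = no (λ { (spre _ _ sat) → ¬sat sat })
  sat? P (t ⊕ u) with sat? P t | sat? P u
  ... | yes sat | _ = yes (sumˡ sat)
  ... | no _ | yes sat = yes (sumʳ sat)
  ... | no ¬satˡ | no ¬satʳ = no (λ { (sumˡ sat) → ¬satˡ sat ; (sumʳ sat) → ¬satʳ sat })
  sat? P (∂ B Q t) with P ∈? Q | sat? P t
  ... | yes p∈Q | _ = no (λ { (senc p∉Q _) → p∉Q p∈Q })
  ... | no p∉Q | yes sat = yes (senc p∉Q sat)
  ... | no _ | no ¬sat = no (λ { (senc _ sat) → ¬sat sat })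

  survives? : ∀ Q (t : Closed) → Decidable (λ P → P ∉ Q × Sat P t)
  survives? Q t P = ¬? (P ∈? Q) ×-dec sat? P t

  survivors : Subset m → Closed → List Pred
  survivors Q t = filter (survives? Q t) (allFin m)

  survivors-spec : ∀ Q t P → (P ∈L survivors Q t) ⇔ (P ∉ Q × Sat P t)
  survivors-spec Q t P =
    mk⇔ (proj₂ ∘ ∈-filter⁻ (survives? Q t) {xs = allFin m}) (∈-filter⁺ (survives? Q t) (∈-allFin P))

  closedSumκ : List Pred → Closed
  closedSumκ [] = δ
  closedSumκ (P ∷ []) = κ P
  closedSumκ (P ∷ P' ∷ L) = κ P ⊕ closedSumκ (P' ∷ L)

  embed-sumκ : ∀ L → embed (closedSumκ L) ≡.≡ sumκ L
  embed-sumκ [] = ≡.refl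
  embed-sumκ (P ∷ []) = ≡.refl
  embed-sumκ (P ∷ P' ∷ L) = ≡.cong (κ P ⊕_) (embed-sumκ (P' ∷ L))

  basic-sumκ : ∀ {k} L → Basic k (closedSumκ L)
  basic-sumκ [] = bδ
  basic-sumκ (P ∷ []) = bκ
  basic-sumκ (P ∷ P' ∷ L) = b⊕ bκ (basic-sumκ (P' ∷ L))

  ∂-elim : ∀ {k} B Q {b} → Basic k b → ∃ λ b' → Basic k b' × ∂ B Q b ≐ b'
  ∂-elim B Q bδ = δ , bδ , ax ∂δ
  ∂-elim B Q (bκ {P = P}) with P ∈? Q
  ... | yes p∈Q = δ , bδ , ax (∂κin p∈Q)
  ... | no p∉Q = κ P , bκ , ax (∂κout p∉Q)
  ∂-elim B Q (b∙ {a = a} {t = t} bt) with a ∈? B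
  ... | yes a∈B =
    closedSumκ L , basic-sumκ L ,
    ≡.subst (⊢ embed (∂ B Q (a ∙ t)) ≈_) (≡.sym (embed-sumκ L))
            (ax (∂block t L a∈B (survivors-spec Q (a ∙ t))))
    where
    L : List Pred
    L = survivors Q (a ∙ t)
  ... | no a∉B with ∂-elim ∅ (Q ∩ PI) bt
  ...   | t' , bt' , ∂t≐t' = a ∙ t' , b∙ bt' , (begin
    ∂ B Q (a ∙ t)            ≈⟨ subst ⟪ t , δ , δ ⟫ (ax (∂pass a∉B)) ⟩
    ∂ ∅ Q (a ∙ t)            ≈⟨ subst ⟪ t , δ , δ ⟫ (ax ∂pre) ⟩
    a ∙ ∂ ∅ (Q ∩ PI) t       ≈⟨ cong∙ ∂t≐t' ⟩
    a ∙ t'                   ∎)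
  ∂-elim B Q (b⊕ {t = x} {u = y} bx by) with ∂-elim B Q bx | ∂-elim B Q by
  ... | x' , bx' , ∂x≐x' | y' , by' , ∂y≐y' =
    x' ⊕ y' , b⊕ bx' by' , trans (subst ⟪ x , y , δ ⟫ (ax ∂sum)) (cong⊕ ∂x≐x' ∂y≐y')

  normalise : ∀ (s : Closed) → ∃₂ λ k b → Basic k b × s ≐ b
  normalise (var ())
  normalise δ = 0 , δ , bδ , refl
  normalise (κ P) = 0 , κ P , bκ , refl
  normalise (a ∙ s) with normalise s
  ... | k , b , bb , s≐b = suc k , a ∙ b , b∙ bb , cong∙ s≐b
  normalise (s ⊕ u) with normalise s | normalise u
  ... | j , b , bb , s≐b | k , c , bc , u≐c =
    j ⊔ k , b ⊕ c , b⊕ (basic-weaken (m≤m⊔n j k) bb) (basic-weaken (m≤n⊔m j k) bc) , cong⊕ s≐b u≐c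
  normalise (∂ B Q s) with normalise s
  ... | k , b , bb , s≐b with ∂-elim B Q bb
  ...   | b' , bb' , ∂b≐b' = k , b' , bb' , trans (cong∂ s≐b) ∂b≐b'

  bisimilar⇒provable : ∀ {s t} → s ∼ t → s ≐ t
  bisimilar⇒provable {s} {t} s∼t with normalise s | normalise t
  ... | j , b , bb , s≐b | k , c , bc , t≐c = begin
    s  ≈⟨ s≐b ⟩
    b  ≈⟨ bisimilar-basic (basic-weaken (m≤m⊔n j k) bb) (basic-weaken (m≤n⊔m j k) bc) b∼c ⟩
    c  ≈⟨ t≐c ⟨
    t  ∎
    where
    b∼c : b ∼ c
    b∼c = ∼-trans (provable⇒bisimilar (sym s≐b)) (∼-trans s∼t (provable⇒bisimilar t≐c))

corollary12 : (n m : ℕ) (PI : Subset m) (AP : Fin m → Subset (suc n)) →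
    let open FTP n m PI AP in
    (s t : Closed) → (⊢ embed s ≈ embed t) ⇔ (s ∼ t)
corollary12 n m PI AP s t = mk⇔ provable⇒bisimilar bisimilar⇒provable
  where open Axiomatisation n m PI AP
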